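{- Let $g:\mathbb{F}_2^5\to\mathbb{F}_2$ be $$\begin{aligned}g(X_5,X_4,X_3,X_2,X_1)={}&X_3X_2X_1\oplus X_4\oplus X_4X_1\oplus X_4X_2\oplus X_4X_2X_1\oplus X_4X_3X_1\oplus X_4X_3X_2\\&\oplus X_5\oplus X_5X_1\oplus X_5X_2X_1\oplus X_5X_3\oplus X_5X_3X_1\oplus X_5X_3X_2\oplus X_5X_4\\&\oplus X_5X_4X_1\oplus X_5X_4X_2\oplus X_5X_4X_3,\end{aligned}$$ let $g_0:\mathbb{F}_2^6\to\mathbb{F}_2$ be $g_0(X_6,X_5,\ldots,X_1)=(1\oplus X_6)\,g(X_5,\ldots,X_1)\oplus X_6\,g(1\oplus X_5,\ldots,1\oplus X_1)$, and let $G_0=g_0\diamond g$, a $30$-variable Boolean function. Then $H_\infty(G_0)/\mathrm{Inf}(G_0)=128/45$. In particular, there exists a Boolean function $f$ with $H_\infty(f)/\mathrm{Inf}(f)=128/45$.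
   Context: Logarithms are base $2$. For an $m$-variable Boolean function $f:\mathbb{F}_2^m\to\mathbb{F}_2$: the Walsh transform is $W_f(\boldsymbol{\alpha})=2^{ -m}\sum_{\mathbf{x}}(-1)^{f(\mathbf{x})\oplus\langle\mathbf{x},\boldsymbol{\alpha}\rangle}$ with $\langle\mathbf{x},\boldsymbol{\alpha}\rangle=\bigoplus_j x_j\alpha_j$; the min-entropy is $H_\infty(f)=\min_{\boldsymbol{\alpha}:W_f^2(\boldsymbol{\alpha})\neq0}\log\frac{1}{W_f^2(\boldsymbol{\alpha})}$; the (total) influence is $\mathrm{Inf}(f)=\sum_{i=1}^m\Pr_{\mathbf{x}}[f(\mathbf{x})\neq f(\mathbf{x}\oplus\mathbf{e}_i)]$ ($\mathbf{x}$ uniform, $\mathbf{e}_i$ the $i$-th unit vector). The disjoint composition of a $k$-variable $f$ and an $l$-variable $h$ is the $kl$-variable function $(f\diamond h)(\mathbf{X})=f(h(\mathbf{X}^{(1)}),\ldots,h(\mathbf{X}^{(k)}))$, where $\mathbf{X}^{(i)}$ is the $i$-th block of $l$ consecutive variables of $\mathbf{X}$. -}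

module Defs where

open import Data.Bool using (Bool; true; false; not; _∧_; _xor_; if_then_else_)
open import Data.Nat as ℕ using (ℕ; zero; suc)
open import Data.Integer as ℤ using (ℤ; +_; -[1+_])
open import Data.Fin using (Fin; #_; combine; inject₁; _≟_)
open import Data.List using (List; []; _∷_; _++_; map; foldr; allFin)
open import Data.Vec.Functional using () renaming (_∷_ to _∷ᶠ_)
open import Data.Rational using (ℚ; _/_; _*_; _≤_; 1/_; 1ℚ; 0ℚ; ↥_; ↧ₙ_; ≢-nonZero)
open import Relation.Nullary using (does)
open import Data.Nat.Properties using (m^n≢0)
open import Relation.Binary.PropositionalEquality using (_≡_; _≢_)
open import Data.Product using (Σ; ∃; _×_)

-- Boolean functions on F₂^m.  F₂ = Bool (false = 0, true = 1, ⊕ = xor,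
-- product = ∧).  An input is x : Fin m → Bool, where x i is the
-- variable X_{i+1}.

Input : ℕ → Set
Input m = Fin m → Bool

BF : ℕ → Set
BF m = Input m → Bool

allInputs : (m : ℕ) → List (Input m)
allInputs zero    = (λ ()) ∷ []
allInputs (suc m) = map (false ∷ᶠ_) (allInputs m) ++ map (true ∷ᶠ_) (allInputs m)

sumℤ : List ℤ → ℤ
sumℤ = foldr ℤ._+_ (+ 0)

sumℕ : List ℕ → ℕ
sumℕ = foldr ℕ._+_ 0

_^ℕ_ : ℚ → ℕ → ℚ
q ^ℕ zero  = 1ℚ
q ^ℕ suc n = q * (q ^ℕ n)

two^ : ℤ → ℚ
two^ (+ n)      = (+ (2 ℕ.^ n)) / 1
two^ -[1+ n ]   = _/_ (+ 1) (2 ℕ.^ suc n) {{m^n≢0 2 (suc n)}}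

-- log₂ y ≡ h  (for y > 0), written out: 2^h = y, i.e. with h = p/q in
-- lowest terms (q > 0):  y^q = 2^p.
IsLog2 : ℚ → ℚ → Set
IsLog2 y h = y ^ℕ (↧ₙ h) ≡ two^ (↥ h)

-- h ≤ log₂ y  (for y > 0), i.e. 2^h ≤ y, i.e. 2^p ≤ y^q.
Log2≥ : ℚ → ℚ → Set
Log2≥ y h = two^ (↥ h) ≤ y ^ℕ (↧ₙ h)

inner : {m : ℕ} → Input m → Input m → Bool
inner {m} x α = foldr _xor_ false (map (λ j → x j ∧ α j) (allFin m))

sign : Bool → ℤ
sign false = + 1
sign true  = ℤ.- (+ 1)

W : {m : ℕ} → BF m → Input m → ℚ
W {m} f α = (sumℤ (map (λ x → sign (f x xor inner x α)) (allInputs m)) / 1)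
            * two^ (ℤ.- (+ m))

W² : {m : ℕ} → BF m → Input m → ℚ
W² f α = W f α * W f α

IsMinEntropy : {m : ℕ} → BF m → ℚ → Set
IsMinEntropy {m} f h =
  (Σ (Input m) λ α → Σ (W² f α ≢ 0ℚ) λ ne →
      IsLog2 (1/_ (W² f α) {{≢-nonZero ne}}) h)
  × ((α : Input m) (ne : W² f α ≢ 0ℚ) →
      Log2≥ (1/_ (W² f α) {{≢-nonZero ne}}) h)

flip : {m : ℕ} → Fin m → Input m → Input m
flip i x j = if does (j ≟ i) then not (x j) else x j

differ : Bool → Bool → ℕ
differ a b = if a xor b then 1 else 0

Inf : {m : ℕ} → BF m → ℚ
Inf {m} f =
  (+ sumℕ (map (λ i → sumℕ (map (λ x → differ (f x) (f (flip i x))) (allInputs m)))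
                 (allFin m)) / 1)
  * two^ (ℤ.- (+ m))

-- disjoint composition (f ◇ h)(X) = f(h(X⁽¹⁾), …, h(X⁽ᵏ⁾)), where the
-- i-th block X⁽ⁱ⁾ consists of the variables X_{i·l + j}, j < l.
_◇_ : {k l : ℕ} → BF k → BF l → BF (k ℕ.* l)
(f ◇ h) X = f (λ i → h (λ j → X (combine i j)))

g : BF 5
g x = (X3 ∧ X2 ∧ X1) xor X4 xor (X4 ∧ X1) xor (X4 ∧ X2) xor (X4 ∧ X2 ∧ X1)
      xor (X4 ∧ X3 ∧ X1) xor (X4 ∧ X3 ∧ X2)
      xor X5 xor (X5 ∧ X1) xor (X5 ∧ X2 ∧ X1) xor (X5 ∧ X3) xor (X5 ∧ X3 ∧ X1)
      xor (X5 ∧ X3 ∧ X2) xor (X5 ∧ X4)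
      xor (X5 ∧ X4 ∧ X1) xor (X5 ∧ X4 ∧ X2) xor (X5 ∧ X4 ∧ X3)
  where
  X1 = x (# 0)
  X2 = x (# 1)
  X3 = x (# 2)
  X4 = x (# 3)
  X5 = x (# 4)

g₀ : BF 6
g₀ x = (not X6 ∧ g y) xor (X6 ∧ g (λ i → not (y i)))
  where
  X6 = x (# 5)
  y : Input 5
  y i = x (inject₁ i)

G₀ : BF 30
G₀ = g₀ ◇ g

module Submission where

-- A sum over the 2³⁰ inputs of G₀ of a quantity that factors over the six
-- blocks can be summed block by block over the fibres g⁻¹(0) and g⁻¹(1); what remains is a sum
-- over the 2⁶ inputs of g₀ weighted by fibre sums of g.
--
-- For the Walsh sum at α = (β₁, …, β₆) the weights are the fibre sums of the characters χ βᵢ.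
-- They are (16, 16) when βᵢ = 0 and a·(1, −1) with a ∈ {0, 4, −4} otherwise, so the Walsh sum
-- of G₀ is ∏ aᵢ times the Walsh sum of g₀ at the pattern t of nonzero βᵢ.  The Walsh sums of g₀
-- are ±16 on the fifteen inputs of weight two and on the all-ones input, and vanish elsewhere.
-- A nonzero Walsh sum of G₀ therefore has at least two factors of modulus at most 4, whence
-- |W_{G₀}| ≤ 16⁴ · 4² · 16 / 2³⁰ = 2⁻⁶, with equality at α = e₁ + e₆: H∞(G₀) = 12.
--
-- For the influence, flipping variable j of block i changes G₀ exactly when it changes g on that
-- block and the induced flip of the i-th input of g₀ changes g₀.  Both fibres of g have size 16
-- and contain exactly 6 inputs sensitive to any given variable, so Inf(G₀) = Inf(g₀) · Inf(g)
-- = 9/4 · 15/8 = 135/32, and 12 = (128/45) · (135/32).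

open import Defs
open import Data.Bool using (Bool; true; false; not; _∧_; _∨_; _xor_; if_then_else_; T)
open import Data.Bool.ListAction using (all)
open import Data.Empty using (⊥-elim)
open import Data.Fin as Fin using (Fin; zero; suc; combine; quotient; remainder; _↑ˡ_; _↑ʳ_)
open import Data.Fin.Patterns using (0F; 1F; 2F; 3F; 4F)
open import Data.Fin.Properties
  using (suc-injective; combine-injectiveˡ; combine-injectiveʳ; combine-remQuot)
open import Data.Integer as ℤ using (ℤ; +_; -_; _+_; _*_)
import Data.Integer.Properties as ℤP
open import Data.Integer.Tactic.RingSolver using (solve-∀)
open import Data.List using (List; []; _∷_; _++_; map; foldr; allFin; tabulate)
import Data.List.Properties as List
open import Data.List.Membership.Propositional using (_∈_)
open import Data.List.Relation.Unary.Any using (here; there)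
import Data.List.Relation.Unary.All as All
open import Data.List.Relation.Unary.All.Properties using (all⁺)
open import Data.Nat as ℕ using (ℕ; zero; suc)
open import Data.Product using (Σ; _×_; _,_; proj₁; proj₂)
open import Data.Rational as ℚ using (ℚ; _/_; 0ℚ; 1/_; ≢-nonZero; ↥_; ↧ₙ_)
import Data.Rational.Properties as ℚ
open import Data.Sum using (inj₁; inj₂)
open import Data.Vec as Vec using (Vec; []) renaming (_∷_ to _∷ᵥ_)
import Data.Vec.Properties as Vec
open import Data.Vec.Functional using (toVec; fromVec) renaming (_∷_ to _∷ᶠ_; _++_ to _++ᶠ_)
open import Data.Vec.Functional.Properties using (∷-cong; lookup-++ˡ; lookup-++ʳ)
open import Function using (_∘_; const)
open import Function.Definitions using (Congruent)
open import Relation.Binary.PropositionalEquality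
open import Relation.Nullary using (Dec; does; yes; no)
open import Relation.Nullary.Decidable using (isYes; toWitness; _×-dec_; map′)
open import Algebra.Properties.CommutativeMonoid.Sum ℤP.*-1-commutativeMonoid
  using () renaming (sum to ∏; sum-cong-≗ to ∏-cong; ∑-distrib-+ to ∏-distrib-*)
open import Algebra.Properties.CommutativeSemigroup ℤP.+-commutativeSemigroup
  using () renaming (interchange to +-interchange)
open import Algebra.Properties.CommutativeSemigroup ℤP.*-commutativeSemigroup
  using () renaming (x∙yz≈y∙xz to x*yz≡y*xz)
open ≡-Reasoning

private
  variable
    k l m : ℕ
    A : Set

Ext : {B : Set} → ((Fin m → A) → B) → Set
Ext = Congruent _≗_ _≡_

-- Sums over the Boolean cube

sumℤ-++ : (xs ys : List ℤ) → sumℤ (xs ++ ys) ≡ sumℤ xs + sumℤ ys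
sumℤ-++ []       ys = sym (ℤP.+-identityˡ _)
sumℤ-++ (x ∷ xs) ys = trans (cong (_+_ x) (sumℤ-++ xs ys)) (sym (ℤP.+-assoc x _ _))

sumℤ-map-*ˡ : ∀ c (φ : A → ℤ) xs → sumℤ (map (λ x → c * φ x) xs) ≡ c * sumℤ (map φ xs)
sumℤ-map-*ˡ c φ []       = sym (ℤP.*-zeroʳ c)
sumℤ-map-*ˡ c φ (x ∷ xs) =
  trans (cong (_+_ (c * φ x)) (sumℤ-map-*ˡ c φ xs)) (sym (ℤP.*-distribˡ-+ c (φ x) _))

sumℤ-map-+ : ∀ (φ ψ : A → ℤ) xs →
  sumℤ (map (λ x → φ x + ψ x) xs) ≡ sumℤ (map φ xs) + sumℤ (map ψ xs)
sumℤ-map-+ φ ψ []       = refl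
sumℤ-map-+ φ ψ (x ∷ xs) =
  trans (cong (_+_ (φ x + ψ x)) (sumℤ-map-+ φ ψ xs)) (+-interchange (φ x) (ψ x) _ _)

+-sumℕ : (φ : A → ℕ) (xs : List A) → + sumℕ (map φ xs) ≡ sumℤ (map (+_ ∘ φ) xs)
+-sumℕ φ []       = refl
+-sumℕ φ (x ∷ xs) = cong (_+_ (+ φ x)) (+-sumℕ φ xs)

-- ∑ is opaque so that the typechecker never unfolds a sum over 2³⁰ inputs by accident; the
-- finite checks below unfold it explicitly.
opaque
  ∑ : (m : ℕ) → (Input m → ℤ) → ℤ
  ∑ m φ = sumℤ (map φ (allInputs m))

  ∑-cong : {φ ψ : Input m → ℤ} → φ ≗ ψ → ∑ m φ ≡ ∑ m ψ
  ∑-cong {m} eq = cong sumℤ (List.map-cong eq (allInputs m))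

  ∑-distribˡ : ∀ c (φ : Input m → ℤ) → ∑ m (λ x → c * φ x) ≡ c * ∑ m φ
  ∑-distribˡ {m} c φ = sumℤ-map-*ˡ c φ (allInputs m)

  ∑-distrib-+ : (φ ψ : Input m → ℤ) → ∑ m (λ x → φ x + ψ x) ≡ ∑ m φ + ∑ m ψ
  ∑-distrib-+ {m} φ ψ = sumℤ-map-+ φ ψ (allInputs m)

  ∑-zero : (φ : Input 0 → ℤ) → Ext φ → ∀ x → ∑ 0 φ ≡ φ x
  ∑-zero φ φ-ext x = trans (ℤP.+-identityʳ _) (φ-ext (λ ()))

  ∑-suc : ∀ m (φ : Input (suc m) → ℤ) →
    ∑ (suc m) φ ≡ ∑ m (φ ∘ (false ∷ᶠ_)) + ∑ m (φ ∘ (true ∷ᶠ_))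
  ∑-suc m φ = begin
    sumℤ (map φ (map (false ∷ᶠ_) xs ++ map (true ∷ᶠ_) xs))
      ≡⟨ cong sumℤ (List.map-++ φ (map (false ∷ᶠ_) xs) _) ⟩
    sumℤ (map φ (map (false ∷ᶠ_) xs) ++ map φ (map (true ∷ᶠ_) xs))
      ≡⟨ sumℤ-++ (map φ (map (false ∷ᶠ_) xs)) _ ⟩
    sumℤ (map φ (map (false ∷ᶠ_) xs)) + sumℤ (map φ (map (true ∷ᶠ_) xs))
      ≡⟨ cong₂ _+_ (cong sumℤ (sym (List.map-∘ xs))) (cong sumℤ (sym (List.map-∘ xs))) ⟩
    sumℤ (map (φ ∘ (false ∷ᶠ_)) xs) + sumℤ (map (φ ∘ (true ∷ᶠ_)) xs) ∎
    where
    xs : List (Input m)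
    xs = allInputs m

∑-distribʳ : ∀ c (φ : Input m → ℤ) → ∑ m (λ x → φ x * c) ≡ ∑ m φ * c
∑-distribʳ c φ = begin
  ∑ _ (λ x → φ x * c) ≡⟨ ∑-cong (λ x → ℤP.*-comm (φ x) c) ⟩
  ∑ _ (λ x → c * φ x) ≡⟨ ∑-distribˡ c φ ⟩
  c * ∑ _ φ           ≡⟨ ℤP.*-comm c _ ⟩
  ∑ _ φ * c           ∎

∷-ext : (φ : Input (suc m) → A) → Ext φ → ∀ b → Ext (φ ∘ (b ∷ᶠ_))
∷-ext φ φ-ext b eq = φ-ext (∷-cong refl eq)

∷-++ : ∀ (b : Bool) (u : Input k) (v : Input l) → (b ∷ᶠ u) ++ᶠ v ≗ b ∷ᶠ (u ++ᶠ v)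
∷-++ b u v zero = refl
∷-++ {k} b u v (suc i) with Fin.splitAt k i
... | inj₁ _ = refl
... | inj₂ _ = refl

∑-++ : ∀ k l (φ : Input (k ℕ.+ l) → ℤ) → Ext φ →
  ∑ (k ℕ.+ l) φ ≡ ∑ k (λ u → ∑ l (λ v → φ (u ++ᶠ v)))
∑-++ zero    l φ φ-ext = sym (∑-zero _ (λ _ → refl) (λ ()))
∑-++ (suc k) l φ φ-ext = begin
  ∑ (suc k ℕ.+ l) φ
    ≡⟨ ∑-suc (k ℕ.+ l) φ ⟩
  ∑ (k ℕ.+ l) (φ ∘ (false ∷ᶠ_)) + ∑ (k ℕ.+ l) (φ ∘ (true ∷ᶠ_))
    ≡⟨ cong₂ _+_ (∑-++ k l _ (∷-ext φ φ-ext false)) (∑-++ k l _ (∷-ext φ φ-ext true)) ⟩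
  ∑ k (λ u → ∑ l (λ v → φ (false ∷ᶠ (u ++ᶠ v)))) + ∑ k (λ u → ∑ l (λ v → φ (true ∷ᶠ (u ++ᶠ v))))
    ≡⟨ cong₂ _+_ (reassociate false) (reassociate true) ⟨
  ∑ k (λ u → ∑ l (λ v → φ ((false ∷ᶠ u) ++ᶠ v))) + ∑ k (λ u → ∑ l (λ v → φ ((true ∷ᶠ u) ++ᶠ v)))
    ≡⟨ ∑-suc k _ ⟨
  ∑ (suc k) (λ u → ∑ l (λ v → φ (u ++ᶠ v))) ∎
  where
  reassociate : ∀ b → ∑ k (λ u → ∑ l (λ v → φ ((b ∷ᶠ u) ++ᶠ v)))
                    ≡ ∑ k (λ u → ∑ l (λ v → φ (b ∷ᶠ (u ++ᶠ v))))
  reassociate b = ∑-cong λ u → ∑-cong λ v → φ-ext (∷-++ b u v)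

∏-↑ : ∀ k l (f : Fin (k ℕ.+ l) → ℤ) → ∏ f ≡ ∏ (f ∘ (_↑ˡ l)) * ∏ (f ∘ (k ↑ʳ_))
∏-↑ zero    l f = sym (ℤP.*-identityˡ _)
∏-↑ (suc k) l f = trans (cong (_*_ (f zero)) (∏-↑ k l (f ∘ suc))) (sym (ℤP.*-assoc (f zero) _ _))

∏-combine : ∀ k l (f : Fin (k ℕ.* l) → ℤ) → ∏ f ≡ ∏ {k} (λ i → ∏ {l} (λ j → f (combine i j)))
∏-combine zero    l f = refl
∏-combine (suc k) l f = begin
  ∏ f
    ≡⟨ ∏-↑ l (k ℕ.* l) f ⟩
  ∏ (f ∘ (_↑ˡ k ℕ.* l)) * ∏ (f ∘ (l ↑ʳ_))
    ≡⟨ cong (_*_ (∏ (f ∘ (_↑ˡ k ℕ.* l)))) (∏-combine k l (f ∘ (l ↑ʳ_))) ⟩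
  ∏ (f ∘ (_↑ˡ k ℕ.* l)) * ∏ {k} (λ i → ∏ {l} (λ j → f (l ↑ʳ combine i j))) ∎

∏-ones : (f : Fin k → ℤ) → (∀ i → f i ≡ + 1) → ∏ f ≡ + 1
∏-ones {zero}  f ones = refl
∏-ones {suc k} f ones = cong₂ _*_ (ones zero) (∏-ones (f ∘ suc) (ones ∘ suc))

∏-single : (f : Fin k → ℤ) (i₀ : Fin k) → (∀ i → i ≢ i₀ → f i ≡ + 1) → ∏ f ≡ f i₀
∏-single f zero ones =
  trans (cong (_*_ (f zero)) (∏-ones (f ∘ suc) (λ i → ones (suc i) (λ ())))) (ℤP.*-identityʳ _)
∏-single f (suc i₀) ones = begin
  f zero * ∏ (f ∘ suc) ≡⟨ cong₂ _*_ (ones zero (λ ())) (∏-single (f ∘ suc) i₀ ones′) ⟩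
  + 1 * f (suc i₀)     ≡⟨ ℤP.*-identityˡ _ ⟩
  f (suc i₀)           ∎
  where
  ones′ : ∀ i → i ≢ i₀ → f (suc i) ≡ + 1
  ones′ i i≢i₀ = ones (suc i) (i≢i₀ ∘ suc-injective)

-- Sums over the blocks of a disjoint composition

blocks : Input (k ℕ.* l) → Fin k → Input l
blocks X i j = X (combine i j)

_≗ᵇ_ : (B B′ : Fin k → Input l) → Set
B ≗ᵇ B′ = ∀ i → B i ≗ B′ i

blocks-cong : ∀ {k l} {X Y : Input (k ℕ.* l)} → X ≗ Y → blocks {k} {l} X ≗ᵇ blocks Y
blocks-cong eq i j = eq (combine i j)

∷-congᵇ : ∀ (u : Input l) {B B′ : Fin k → Input l} → B ≗ᵇ B′ → (u ∷ᶠ B) ≗ᵇ (u ∷ᶠ B′)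
∷-congᵇ u eq zero    j = refl
∷-congᵇ u eq (suc i) = eq i

ExtTuple : ((Fin k → Input l) → ℤ) → Set
ExtTuple = Congruent _≗ᵇ_ _≡_

∑Tuples : ∀ k {l} → ((Fin k → Input l) → ℤ) → ℤ
∑Tuples zero    Ψ = Ψ (λ ())
∑Tuples (suc k) Ψ = ∑ _ (λ u → ∑Tuples k (Ψ ∘ (u ∷ᶠ_)))

∑Tuples-cong : {Ψ Ψ′ : (Fin k → Input l) → ℤ} → (∀ B → Ψ B ≡ Ψ′ B) → ∑Tuples k Ψ ≡ ∑Tuples k Ψ′
∑Tuples-cong {zero}  eq = eq _
∑Tuples-cong {suc k} eq = ∑-cong λ u → ∑Tuples-cong (eq ∘ (u ∷ᶠ_))

∑Tuples-distribˡ : ∀ c (Ψ : (Fin k → Input l) → ℤ) → ∑Tuples k (λ B → c * Ψ B) ≡ c * ∑Tuples k Ψ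
∑Tuples-distribˡ {zero}  c Ψ = refl
∑Tuples-distribˡ {suc k} c Ψ =
  trans (∑-cong λ u → ∑Tuples-distribˡ c (Ψ ∘ (u ∷ᶠ_))) (∑-distribˡ c _)

blocks-++ : ∀ (u : Input l) (v : Input (k ℕ.* l)) → blocks {suc k} (u ++ᶠ v) ≗ᵇ (u ∷ᶠ blocks v)
blocks-++ {l} {k} u v zero    j = lookup-++ˡ u v j
blocks-++ {l} {k} u v (suc i) j = lookup-++ʳ u v (combine i j)

∑-blocks : ∀ k l (Ψ : (Fin k → Input l) → ℤ) → ExtTuple Ψ → ∑ (k ℕ.* l) (Ψ ∘ blocks) ≡ ∑Tuples k Ψ
∑-blocks zero    l Ψ Ψ-ext = trans (∑-zero (Ψ ∘ blocks) (Ψ-ext ∘ blocks-cong {0} {l}) (λ ())) (Ψ-ext (λ ()))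
∑-blocks (suc k) l Ψ Ψ-ext = begin
  ∑ (l ℕ.+ k ℕ.* l) (Ψ ∘ blocks)
    ≡⟨ ∑-++ l (k ℕ.* l) (Ψ ∘ blocks) (Ψ-ext ∘ blocks-cong {suc k} {l}) ⟩
  ∑ l (λ u → ∑ (k ℕ.* l) (λ v → Ψ (blocks (u ++ᶠ v))))
    ≡⟨ ∑-cong (λ u → ∑-cong (λ v → Ψ-ext (blocks-++ u v))) ⟩
  ∑ l (λ u → ∑ (k ℕ.* l) (λ v → Ψ (u ∷ᶠ blocks v)))
    ≡⟨ ∑-cong (λ u → ∑-blocks k l (Ψ ∘ (u ∷ᶠ_)) (Ψ-ext ∘ ∷-congᵇ u)) ⟩
  ∑Tuples (suc k) Ψ ∎

δ : Bool → Bool → ℤ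
δ false false = + 1
δ true  true  = + 1
δ _     _     = + 0

fibreSum : BF l → (Input l → ℤ) → Bool → ℤ
fibreSum h w b = ∑ _ (λ u → δ (h u) b * w u)

∑-byFibres : ∀ (h : BF l) (w : Input l → ℤ) (G : Bool → ℤ) →
  ∑ l (λ u → w u * G (h u)) ≡ fibreSum h w false * G false + fibreSum h w true * G true
∑-byFibres h w G = begin
  ∑ _ (λ u → w u * G (h u))
    ≡⟨ ∑-cong (λ u → split (h u) (w u)) ⟩
  ∑ _ (λ u → δ (h u) false * w u * G false + δ (h u) true * w u * G true)
    ≡⟨ ∑-distrib-+ _ _ ⟩
  ∑ _ (λ u → δ (h u) false * w u * G false) + ∑ _ (λ u → δ (h u) true * w u * G true)
    ≡⟨ cong₂ _+_ (∑-distribʳ (G false) _) (∑-distribʳ (G true) _) ⟩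
  fibreSum h w false * G false + fibreSum h w true * G true ∎
  where
  split : ∀ b x → x * G b ≡ δ b false * x * G false + δ b true * x * G true
  split false x = on-false x (G false) (G true)
    where
    on-false : ∀ x a b → x * a ≡ + 1 * x * a + + 0 * x * b
    on-false = solve-∀
  split true  x = on-true x (G false) (G true)
    where
    on-true : ∀ x a b → x * b ≡ + 0 * x * a + + 1 * x * b
    on-true = solve-∀

∘-∷ : (h : Input l → Bool) (u : Input l) (B : Fin k → Input l) → h ∘ (u ∷ᶠ B) ≗ h u ∷ᶠ (h ∘ B)
∘-∷ h u B zero    = refl
∘-∷ h u B (suc i) = refl

∑Tuples-byFibres : ∀ k (F : Input k → ℤ) → Ext F → (h : BF l) (w : Fin k → Input l → ℤ) →
  ∑Tuples k (λ B → F (h ∘ B) * ∏ (λ i → w i (B i)))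
    ≡ ∑ k (λ y → F y * ∏ (λ i → fibreSum h (w i) (y i)))
∑Tuples-byFibres zero    F F-ext h w =
  trans (cong (_* + 1) (F-ext (λ ()))) (sym (∑-zero _ (cong (_* + 1) ∘ F-ext) (λ ())))
∑Tuples-byFibres (suc k) F F-ext h w = begin
  ∑ _ (λ u → ∑Tuples k (λ B → F (h ∘ (u ∷ᶠ B)) * (w zero u * ∏ (λ i → w (suc i) (B i)))))
    ≡⟨ ∑-cong (λ u → ∑Tuples-cong (λ B → rearrange (w zero u) (F-ext (∘-∷ h u B)))) ⟩
  ∑ _ (λ u → ∑Tuples k (λ B → w zero u * (F (h u ∷ᶠ (h ∘ B)) * ∏ (λ i → w (suc i) (B i)))))
    ≡⟨ ∑-cong (λ u → trans (∑Tuples-distribˡ {k} (w zero u) _) (cong (_*_ (w zero u)) (recurse u))) ⟩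
  ∑ _ (λ u → w zero u * G (h u))
    ≡⟨ ∑-byFibres h (w zero) G ⟩
  fibreSum h (w zero) false * G false + fibreSum h (w zero) true * G true
    ≡⟨ cong₂ _+_ (outer false) (outer true) ⟨
  ∑ k (λ y → F (false ∷ᶠ y) * ∏ (λ i → fibreSum h (w i) ((false ∷ᶠ y) i)))
    + ∑ k (λ y → F (true ∷ᶠ y) * ∏ (λ i → fibreSum h (w i) ((true ∷ᶠ y) i)))
    ≡⟨ ∑-suc k _ ⟨
  ∑ (suc k) (λ y → F y * ∏ (λ i → fibreSum h (w i) (y i))) ∎
  where
  G : Bool → ℤ
  G b = ∑ k (λ y → F (b ∷ᶠ y) * ∏ (λ i → fibreSum h (w (suc i)) (y i)))

  rearrange : ∀ {a a′} c {p} → a ≡ a′ → a * (c * p) ≡ c * (a′ * p)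
  rearrange {a} c {p} refl = x*yz≡y*xz a c p

  recurse : ∀ u → ∑Tuples k (λ B → F (h u ∷ᶠ (h ∘ B)) * ∏ (λ i → w (suc i) (B i))) ≡ G (h u)
  recurse u = ∑Tuples-byFibres k _ (∷-ext F F-ext (h u)) h (w ∘ suc)

  outer : ∀ b → ∑ k (λ y → F (b ∷ᶠ y) * (fibreSum h (w zero) b * ∏ (λ i → fibreSum h (w (suc i)) (y i))))
              ≡ fibreSum h (w zero) b * G b
  outer b = trans (∑-cong (λ y → x*yz≡y*xz (F (b ∷ᶠ y)) (fibreSum h (w zero) b) _))
                  (∑-distribˡ (fibreSum h (w zero) b) _)

-- Walsh sums

sign-xor : ∀ a b → sign (a xor b) ≡ sign a * sign b
sign-xor false false = refl
sign-xor false true  = refl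
sign-xor true  false = refl
sign-xor true  true  = refl

sign-foldr-xor : (f : Fin m → Bool) → sign (foldr _xor_ false (tabulate f)) ≡ ∏ (sign ∘ f)
sign-foldr-xor {zero}  f = refl
sign-foldr-xor {suc m} f =
  trans (sign-xor (f zero) _) (cong (_*_ (sign (f zero))) (sign-foldr-xor (f ∘ suc)))

sign-inner : (x α : Input m) → sign (inner x α) ≡ ∏ (λ j → sign (x j ∧ α j))
sign-inner {m} x α =
  trans (cong (sign ∘ foldr _xor_ false) (List.map-tabulate {n = m} (λ i → i) (λ j → x j ∧ α j)))
        (sign-foldr-xor (λ j → x j ∧ α j))

inner-cong : {x x′ α α′ : Input m} → x ≗ x′ → α ≗ α′ → inner x α ≡ inner x′ α′
inner-cong {m} ex eα = cong (foldr _xor_ false) (List.map-cong (λ j → cong₂ _∧_ (ex j) (eα j)) (allFin m))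

sign-inner-blocks : ∀ k l (X α : Input (k ℕ.* l)) →
  sign (inner X α) ≡ ∏ (λ i → sign (inner (blocks {k} {l} X i) (blocks α i)))
sign-inner-blocks k l X α = begin
  sign (inner X α)                           ≡⟨ sign-inner X α ⟩
  ∏ (λ t → sign (X t ∧ α t))                 ≡⟨ ∏-combine k l _ ⟩
  ∏ (λ i → ∏ (λ j → sign (X′ i j ∧ α′ i j))) ≡⟨ ∏-cong (λ i → sign-inner (X′ i) (α′ i)) ⟨
  ∏ (λ i → sign (inner (X′ i) (α′ i)))       ∎
  where
  X′ α′ : Fin k → Input l
  X′ = blocks X
  α′ = blocks α

χ : Input m → Input m → ℤ
χ α x = sign (inner x α)

walshSum : BF m → Input m → ℤ
walshSum {m} f α = sumℤ (map (λ x → sign (f x xor inner x α)) (allInputs m))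

walshSum-cong : (f : BF m) {α α′ : Input m} → α ≗ α′ → walshSum f α ≡ walshSum f α′
walshSum-cong {m} f eq =
  cong sumℤ (List.map-cong (λ x → cong (λ c → sign (f x xor c)) (inner-cong (λ _ → refl) eq)) (allInputs m))

opaque
  unfolding ∑

  walshSum-∑ : (f : BF m) (α : Input m) → walshSum f α ≡ ∑ m (λ x → sign (f x) * χ α x)
  walshSum-∑ {m} f α = cong sumℤ (List.map-cong (λ x → sign-xor (f x) (inner x α)) (allInputs m))

walshSum-∏ : (f : BF m) (α : Input m) → walshSum f α ≡ ∑ m (λ x → sign (f x) * ∏ (λ j → sign (x j ∧ α j)))
walshSum-∏ f α = trans (walshSum-∑ f α) (∑-cong (λ x → cong (_*_ (sign (f x))) (sign-inner x α)))

walshSum-◇ : (f : BF k) (h : BF l) → Ext f → Ext h → ∀ α →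
  walshSum (f ◇ h) α ≡ ∑ k (λ y → sign (f y) * ∏ (λ i → fibreSum h (χ (blocks α i)) (y i)))
walshSum-◇ {k} {l} f h f-ext h-ext α = begin
  walshSum (f ◇ h) α
    ≡⟨ walshSum-∑ (f ◇ h) α ⟩
  ∑ (k ℕ.* l) (λ X → sign ((f ◇ h) X) * χ α X)
    ≡⟨ ∑-cong (λ X → cong (_*_ (sign ((f ◇ h) X))) (sign-inner-blocks k l X α)) ⟩
  ∑ (k ℕ.* l) (Ψ ∘ blocks)
    ≡⟨ ∑-blocks k l Ψ Ψ-ext ⟩
  ∑Tuples k Ψ
    ≡⟨ ∑Tuples-byFibres k (sign ∘ f) (cong sign ∘ f-ext) h (χ ∘ blocks α) ⟩
  ∑ k (λ y → sign (f y) * ∏ (λ i → fibreSum h (χ (blocks α i)) (y i))) ∎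
  where
  Ψ : (Fin k → Input l) → ℤ
  Ψ B = sign (f (h ∘ B)) * ∏ (λ i → χ (blocks α i) (B i))

  Ψ-ext : ExtTuple Ψ
  Ψ-ext eq = cong₂ _*_ (cong sign (f-ext (λ i → h-ext (eq i))))
                       (∏-cong (λ i → cong sign (inner-cong (eq i) (λ _ → refl))))

walshSum-◇-factor : (f : BF k) (h : BF l) → Ext f → Ext h →
  (α : Input (k ℕ.* l)) (a : Fin k → ℤ) (t : Input k) →
  (∀ i b → fibreSum h (χ (blocks α i)) b ≡ a i * sign (b ∧ t i)) →
  walshSum (f ◇ h) α ≡ ∏ a * walshSum f t
walshSum-◇-factor {k} f h f-ext h-ext α a t fibres = begin
  walshSum (f ◇ h) α
    ≡⟨ walshSum-◇ f h f-ext h-ext α ⟩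
  ∑ k (λ y → sign (f y) * ∏ (λ i → fibreSum h (χ (blocks α i)) (y i)))
    ≡⟨ ∑-cong (λ y → cong (_*_ (sign (f y))) (∏-cong (λ i → fibres i (y i)))) ⟩
  ∑ k (λ y → sign (f y) * ∏ (λ i → a i * sign (y i ∧ t i)))
    ≡⟨ ∑-cong (λ y → cong (_*_ (sign (f y))) (∏-distrib-* a (λ i → sign (y i ∧ t i)))) ⟩
  ∑ k (λ y → sign (f y) * (∏ a * ∏ (λ i → sign (y i ∧ t i))))
    ≡⟨ ∑-cong (λ y → x*yz≡y*xz (sign (f y)) (∏ a) _) ⟩
  ∑ k (λ y → ∏ a * (sign (f y) * ∏ (λ i → sign (y i ∧ t i))))
    ≡⟨ ∑-distribˡ (∏ a) _ ⟩
  ∏ a * ∑ k (λ y → sign (f y) * ∏ (λ i → sign (y i ∧ t i)))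
    ≡⟨ cong (_*_ (∏ a)) (walshSum-∏ f t) ⟨
  ∏ a * walshSum f t ∎

squaredWalsh : ℕ → ℤ → ℚ
squaredWalsh m v = w ℚ.* w
  where
  w : ℚ
  w = (v / 1) ℚ.* two^ (- (+ m))

EntropyAttained : ℕ → ℚ → ℤ → Set
EntropyAttained m h v = Σ (squaredWalsh m v ≢ 0ℚ) λ ne → IsLog2 (1/_ (squaredWalsh m v) {{≢-nonZero ne}}) h

EntropyBound : ℕ → ℚ → ℤ → Set
EntropyBound m h v = (ne : squaredWalsh m v ≢ 0ℚ) → Log2≥ (1/_ (squaredWalsh m v) {{≢-nonZero ne}}) h

entropyBound? : ∀ m h v → Dec (EntropyBound m h v)
entropyBound? m h v with squaredWalsh m v ℚ.≟ 0ℚ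
... | yes w≡0 = yes (λ w≢0 → ⊥-elim (w≢0 w≡0))
... | no  w≢0 = map′ (λ bound _ → bound) (λ bound → bound w≢0)
                     (two^ (↥ h) ℚ.≤? (1/_ (squaredWalsh m v) {{≢-nonZero w≢0}}) ^ℕ (↧ₙ h))

-- Kept abstract in f: for a concrete f, unifying W² f α with squaredWalsh m (walshSum f α)
-- would make Agda evaluate the Walsh sum.
isMinEntropy-byWalshSums : ∀ (f : BF m) h α₀ v₀ → walshSum f α₀ ≡ v₀ → EntropyAttained m h v₀ →
  (∀ α → EntropyBound m h (walshSum f α)) → IsMinEntropy f h
isMinEntropy-byWalshSums {m} f h α₀ v₀ eq attained bound =
  (α₀ , subst (EntropyAttained m h) (sym eq) attained) , bound

-- Influence

sensitiveAt : BF m → Fin m → Input m → ℤ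
sensitiveAt f i x = + differ (f x) (f (flip i x))

sensitivity : BF m → Fin m → ℤ
sensitivity f i = ∑ _ (sensitiveAt f i)

opaque
  unfolding ∑

  Inf-sensitivity : (f : BF m) → Inf f ≡ (sumℤ (map (sensitivity f) (allFin m)) / 1) ℚ.* two^ (- (+ m))
  Inf-sensitivity {m} f = cong (λ z → (z / 1) ℚ.* two^ (- (+ m))) (begin
    + sumℕ (map (λ i → sumℕ (map (λ x → differ (f x) (f (flip i x))) (allInputs m))) (allFin m))
      ≡⟨ +-sumℕ _ (allFin m) ⟩
    sumℤ (map (λ i → + sumℕ (map (λ x → differ (f x) (f (flip i x))) (allInputs m))) (allFin m))
      ≡⟨ cong sumℤ (List.map-cong (λ i → +-sumℕ _ (allInputs m)) (allFin m)) ⟩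
    sumℤ (map (sensitivity f) (allFin m)) ∎)

flip-≡ : ∀ (i : Fin m) x → flip i x i ≡ not (x i)
flip-≡ i x with i Fin.≟ i
... | yes _   = refl
... | no i≢i = ⊥-elim (i≢i refl)

flip-≢ : ∀ {i j : Fin m} x → j ≢ i → flip i x j ≡ x j
flip-≢ {i = i} {j} x j≢i with j Fin.≟ i
... | yes j≡i = ⊥-elim (j≢i j≡i)
... | no _    = refl

flip-cong : ∀ (i : Fin m) {x y} → x ≗ y → flip i x ≗ flip i y
flip-cong i eq j with j Fin.≟ i
... | yes _ = cong not (eq j)
... | no _  = eq j

sensitiveAt-cong : (f : BF m) → Ext f → ∀ i → Ext (sensitiveAt f i)
sensitiveAt-cong f f-ext i eq = cong₂ (λ a b → + differ a b) (f-ext eq) (f-ext (flip-cong i eq))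

≗-off : ∀ (i₀ : Fin m) {y z : Input m} → (∀ i → i ≢ i₀ → y i ≡ z i) → y i₀ ≡ z i₀ → y ≗ z
≗-off i₀ off at i with i Fin.≟ i₀
... | yes refl = at
... | no i≢i₀ = off i i≢i₀

differ-self : ∀ b → differ b b ≡ 0
differ-self false = refl
differ-self true  = refl

module _ (f : BF m) (f-ext : Ext f) (i₀ : Fin m) {y y′ : Input m} (off : ∀ i → i ≢ i₀ → y′ i ≡ y i) where

  differ-unchanged : y′ i₀ ≡ y i₀ → + differ (f y) (f y′) ≡ sensitiveAt f i₀ y * + 0
  differ-unchanged at = begin
    + differ (f y) (f y′)    ≡⟨ cong (λ z → + differ (f y) z) (f-ext (≗-off i₀ off at)) ⟩
    + differ (f y) (f y)     ≡⟨ cong +_ (differ-self (f y)) ⟩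
    + 0                      ≡⟨ ℤP.*-zeroʳ (sensitiveAt f i₀ y) ⟨
    sensitiveAt f i₀ y * + 0 ∎

  differ-flipped : y′ i₀ ≡ not (y i₀) → + differ (f y) (f y′) ≡ sensitiveAt f i₀ y * + 1
  differ-flipped at = begin
    + differ (f y) (f y′)    ≡⟨ cong (λ z → + differ (f y) z) (f-ext (≗-off i₀ off′ (trans at (sym (flip-≡ i₀ y))))) ⟩
    sensitiveAt f i₀ y       ≡⟨ ℤP.*-identityʳ (sensitiveAt f i₀ y) ⟨
    sensitiveAt f i₀ y * + 1 ∎
    where
    off′ : ∀ i → i ≢ i₀ → y′ i ≡ flip i₀ y i
    off′ i i≢i₀ = trans (off i i≢i₀) (sym (flip-≢ y i≢i₀))

  sensitiveAt-update : + differ (f y) (f y′) ≡ sensitiveAt f i₀ y * + differ (y i₀) (y′ i₀)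
  sensitiveAt-update with y i₀ in a | y′ i₀ in b
  ... | false | false = differ-unchanged (trans b (sym a))
  ... | true  | true  = differ-unchanged (trans b (sym a))
  ... | false | true  = differ-flipped (trans b (sym (cong not a)))
  ... | true  | false = differ-flipped (trans b (sym (cong not a)))

blocks-flip-≢ : ∀ (X : Input (k ℕ.* l)) {i₀ i : Fin k} (j₀ : Fin l) → i ≢ i₀ →
  blocks (flip (combine i₀ j₀) X) i ≗ blocks {k} {l} X i
blocks-flip-≢ X {i₀} {i} j₀ i≢i₀ j = flip-≢ X (i≢i₀ ∘ combine-injectiveˡ i j i₀ j₀)

blocks-flip-≡ : ∀ (X : Input (k ℕ.* l)) (i₀ : Fin k) (j₀ : Fin l) →
  blocks (flip (combine i₀ j₀) X) i₀ ≗ flip j₀ (blocks {k} {l} X i₀)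
blocks-flip-≡ X i₀ j₀ = ≗-off j₀ off (trans (flip-≡ (combine i₀ j₀) X) (sym (flip-≡ j₀ (blocks X i₀))))
  where
  off : ∀ j → j ≢ j₀ → blocks (flip (combine i₀ j₀) X) i₀ j ≡ flip j₀ (blocks X i₀) j
  off j j≢j₀ = trans (flip-≢ X (j≢j₀ ∘ combine-injectiveʳ i₀ j i₀ j₀)) (sym (flip-≢ (blocks X i₀) j≢j₀))

blockWeight : BF l → Fin k → Fin l → Fin k → Input l → ℤ
blockWeight h i₀ j₀ i = if does (i Fin.≟ i₀) then sensitiveAt h j₀ else const (+ 1)

blockWeight-≡ : ∀ (h : BF l) (i₀ : Fin k) j₀ u → blockWeight h i₀ j₀ i₀ u ≡ sensitiveAt h j₀ u
blockWeight-≡ h i₀ j₀ u with i₀ Fin.≟ i₀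
... | yes _     = refl
... | no i₀≢i₀ = ⊥-elim (i₀≢i₀ refl)

blockWeight-≢ : ∀ (h : BF l) {i₀ i : Fin k} j₀ u → i ≢ i₀ → blockWeight h i₀ j₀ i u ≡ + 1
blockWeight-≢ h {i₀} {i} j₀ u i≢i₀ with i Fin.≟ i₀
... | yes i≡i₀ = ⊥-elim (i≢i₀ i≡i₀)
... | no _     = refl

blockWeight-cong : ∀ (h : BF l) → Ext h → (i₀ : Fin k) (j₀ : Fin l) (i : Fin k) →
  Ext (blockWeight h i₀ j₀ i)
blockWeight-cong h h-ext i₀ j₀ i eq with i Fin.≟ i₀
... | yes _ = sensitiveAt-cong h h-ext j₀ eq
... | no _  = refl

module _ (f : BF k) (h : BF l) (f-ext : Ext f) (h-ext : Ext h) (i₀ : Fin k) (j₀ : Fin l) where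

  sensitiveAt-◇ : ∀ X → sensitiveAt (f ◇ h) (combine i₀ j₀) X
    ≡ sensitiveAt f i₀ (h ∘ blocks X) * ∏ (λ i → blockWeight h i₀ j₀ i (blocks X i))
  sensitiveAt-◇ X = begin
    sensitiveAt (f ◇ h) (combine i₀ j₀) X
      ≡⟨ sensitiveAt-update f f-ext i₀ (λ i i≢i₀ → h-ext (blocks-flip-≢ X j₀ i≢i₀)) ⟩
    sensitiveAt f i₀ (h ∘ blocks X) * + differ (h u) (h (blocks (flip (combine i₀ j₀) X) i₀))
      ≡⟨ cong (λ z → sensitiveAt f i₀ (h ∘ blocks X) * + differ (h u) z) (h-ext (blocks-flip-≡ X i₀ j₀)) ⟩
    sensitiveAt f i₀ (h ∘ blocks X) * sensitiveAt h j₀ u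
      ≡⟨ cong (_*_ (sensitiveAt f i₀ (h ∘ blocks X))) weights ⟨
    sensitiveAt f i₀ (h ∘ blocks X) * ∏ (λ i → blockWeight h i₀ j₀ i (blocks X i)) ∎
    where
    u : Input l
    u = blocks X i₀

    weights : ∏ (λ i → blockWeight h i₀ j₀ i (blocks X i)) ≡ sensitiveAt h j₀ u
    weights = trans (∏-single _ i₀ (λ i → blockWeight-≢ h j₀ (blocks X i))) (blockWeight-≡ h i₀ j₀ u)

  sensitivity-◇ : sensitivity (f ◇ h) (combine i₀ j₀)
    ≡ ∑ k (λ y → sensitiveAt f i₀ y * ∏ (λ i → fibreSum h (blockWeight h i₀ j₀ i) (y i)))
  sensitivity-◇ = begin
    sensitivity (f ◇ h) (combine i₀ j₀)
      ≡⟨ ∑-cong sensitiveAt-◇ ⟩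
    ∑ (k ℕ.* l) (Ψ ∘ blocks)
      ≡⟨ ∑-blocks k l Ψ Ψ-ext ⟩
    ∑Tuples k Ψ
      ≡⟨ ∑Tuples-byFibres k (sensitiveAt f i₀) (sensitiveAt-cong f f-ext i₀) h (blockWeight h i₀ j₀) ⟩
    ∑ k (λ y → sensitiveAt f i₀ y * ∏ (λ i → fibreSum h (blockWeight h i₀ j₀ i) (y i))) ∎
    where
    Ψ : (Fin k → Input l) → ℤ
    Ψ B = sensitiveAt f i₀ (h ∘ B) * ∏ (λ i → blockWeight h i₀ j₀ i (B i))

    Ψ-ext : ExtTuple Ψ
    Ψ-ext eq = cong₂ _*_ (sensitiveAt-cong f f-ext i₀ (λ i → h-ext (eq i)))
                         (∏-cong (λ i → blockWeight-cong h h-ext i₀ j₀ i (eq i)))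

module Exhaustive {A : Set} (xs : List A) (complete : ∀ a → a ∈ xs) where

  allTuples : ∀ k → ((Fin k → A) → Bool) → Bool
  allTuples zero    P = P (λ ())
  allTuples (suc k) P = all (λ a → allTuples k (P ∘ (a ∷ᶠ_))) xs

  allTuples-sound : ∀ k (P : (Fin k → A) → Bool) → Ext P → T (allTuples k P) → ∀ t → T (P t)
  allTuples-sound zero    P P-ext ok t = subst T (P-ext (λ ())) ok
  allTuples-sound (suc k) P P-ext ok t =
    subst T (P-ext (∷-cong refl (λ _ → refl))) (allTuples-sound k _ (P-ext ∘ ∷-cong refl) ok-head (t ∘ suc))
    where
    ok-head : T (allTuples k (P ∘ (t zero ∷ᶠ_)))
    ok-head = All.lookup (all⁺ (λ a → allTuples k (P ∘ (a ∷ᶠ_))) xs ok) (complete (t zero))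

bool-complete : ∀ b → b ∈ false ∷ true ∷ []
bool-complete false = here refl
bool-complete true  = there (here refl)

module Inputs = Exhaustive (false ∷ true ∷ []) bool-complete

-- The functions g and g₀

-- g and g₀ read their argument only at numerals, so they cannot tell x from fromVec (toVec x).
g-ext : Ext g
g-ext eq = cong (g ∘ fromVec) (Vec.tabulate-cong eq)

g₀-ext : Ext g₀
g₀-ext eq = cong (g₀ ∘ fromVec) (Vec.tabulate-cong eq)

-- The four possible shapes (16, 16), (0, 0), (4, −4), (−4, 4) of the pair of fibre sums of χ β
-- over g⁻¹(false) and g⁻¹(true).
data Profile : Set where
  constant null plus minus : Profile

amplitude : Profile → ℤ
amplitude constant = + 16
amplitude null     = + 0
amplitude plus     = + 4
amplitude minus    = - (+ 4)

twisted : Profile → Bool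
twisted constant = false
twisted _        = true

profileOf : ℤ → Profile
profileOf v with does (v ℤ.≟ + 16) | does (v ℤ.≟ + 0) | does (v ℤ.≟ + 4)
... | true | _    | _    = constant
... | _    | true | _    = null
... | _    | _    | true = plus
... | _    | _    | _    = minus

profile : Input 5 → Profile
profile β = profileOf (fibreSum g (χ β) false)

Fits : Profile → ℤ → Bool → Set
Fits p v b = v ≡ amplitude p * sign (b ∧ twisted p)

fits? : ∀ p v b → Dec (Fits p v b)
fits? p v b = v ℤ.≟ amplitude p * sign (b ∧ twisted p)

fitsBoth? : ∀ v w → Dec (Fits (profileOf v) v false × Fits (profileOf v) w true)
fitsBoth? v w = fits? (profileOf v) v false ×-dec fits? (profileOf v) w true

fibreSum-χ-cong : ∀ (h : BF l) b → Ext (λ β → fibreSum h (χ β) b)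
fibreSum-χ-cong h b eq = ∑-cong (λ u → cong (λ c → δ (h u) b * sign c) (inner-cong (λ _ → refl) eq))

g-fitsBoth? : Input 5 → Bool
g-fitsBoth? β = isYes (fitsBoth? (fibreSum g (χ β) false) (fibreSum g (χ β) true))

opaque
  unfolding ∑

  g-fitsBoth-checked : T (Inputs.allTuples 5 g-fitsBoth?)
  g-fitsBoth-checked = _

g-fitsBoth : ∀ β → Fits (profile β) (fibreSum g (χ β) false) false
                  × Fits (profile β) (fibreSum g (χ β) true) true
g-fitsBoth β = toWitness {a? = fitsBoth? (fibreSum g (χ β) false) (fibreSum g (χ β) true)}
  (Inputs.allTuples-sound 5 g-fitsBoth? g-fitsBoth?-ext g-fitsBoth-checked β)
  where
  g-fitsBoth?-ext : Ext g-fitsBoth?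
  g-fitsBoth?-ext eq =
    cong₂ (λ v w → isYes (fitsBoth? v w)) (fibreSum-χ-cong g false eq) (fibreSum-χ-cong g true eq)

fibreSum-χ-g : ∀ β b → Fits (profile β) (fibreSum g (χ β) b) b
fibreSum-χ-g β false = proj₁ (g-fitsBoth β)
fibreSum-χ-g β true  = proj₂ (g-fitsBoth β)

walshTable-g₀ : Vec Bool 6 → ℤ
walshTable-g₀ (true  ∷ᵥ true  ∷ᵥ false ∷ᵥ false ∷ᵥ false ∷ᵥ false ∷ᵥ []) = - (+ 16)
walshTable-g₀ (true  ∷ᵥ false ∷ᵥ true  ∷ᵥ false ∷ᵥ false ∷ᵥ false ∷ᵥ []) = - (+ 16)
walshTable-g₀ (false ∷ᵥ true  ∷ᵥ true  ∷ᵥ false ∷ᵥ false ∷ᵥ false ∷ᵥ []) = - (+ 16)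
walshTable-g₀ (true  ∷ᵥ false ∷ᵥ false ∷ᵥ true  ∷ᵥ false ∷ᵥ false ∷ᵥ []) = + 16
walshTable-g₀ (false ∷ᵥ true  ∷ᵥ false ∷ᵥ true  ∷ᵥ false ∷ᵥ false ∷ᵥ []) = + 16
walshTable-g₀ (false ∷ᵥ false ∷ᵥ true  ∷ᵥ true  ∷ᵥ false ∷ᵥ false ∷ᵥ []) = - (+ 16)
walshTable-g₀ (true  ∷ᵥ false ∷ᵥ false ∷ᵥ false ∷ᵥ true  ∷ᵥ false ∷ᵥ []) = + 16
walshTable-g₀ (false ∷ᵥ true  ∷ᵥ false ∷ᵥ false ∷ᵥ true  ∷ᵥ false ∷ᵥ []) = - (+ 16)
walshTable-g₀ (false ∷ᵥ false ∷ᵥ true  ∷ᵥ false ∷ᵥ true  ∷ᵥ false ∷ᵥ []) = + 16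
walshTable-g₀ (false ∷ᵥ false ∷ᵥ false ∷ᵥ true  ∷ᵥ true  ∷ᵥ false ∷ᵥ []) = + 16
walshTable-g₀ (true  ∷ᵥ false ∷ᵥ false ∷ᵥ false ∷ᵥ false ∷ᵥ true  ∷ᵥ []) = - (+ 16)
walshTable-g₀ (false ∷ᵥ true  ∷ᵥ false ∷ᵥ false ∷ᵥ false ∷ᵥ true  ∷ᵥ []) = + 16
walshTable-g₀ (false ∷ᵥ false ∷ᵥ true  ∷ᵥ false ∷ᵥ false ∷ᵥ true  ∷ᵥ []) = + 16
walshTable-g₀ (false ∷ᵥ false ∷ᵥ false ∷ᵥ true  ∷ᵥ false ∷ᵥ true  ∷ᵥ []) = + 16
walshTable-g₀ (false ∷ᵥ false ∷ᵥ false ∷ᵥ false ∷ᵥ true  ∷ᵥ true  ∷ᵥ []) = + 16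
walshTable-g₀ (true  ∷ᵥ true  ∷ᵥ true  ∷ᵥ true  ∷ᵥ true  ∷ᵥ true  ∷ᵥ []) = + 16
walshTable-g₀ _ = + 0

walshSum-g₀-fits? : Input 6 → Bool
walshSum-g₀-fits? s = isYes (walshSum g₀ s ℤ.≟ walshTable-g₀ (toVec s))

walshSum-g₀-checked : T (Inputs.allTuples 6 walshSum-g₀-fits?)
walshSum-g₀-checked = _

walshSum-g₀ : ∀ s → walshSum g₀ s ≡ walshTable-g₀ (toVec s)
walshSum-g₀ s = toWitness {a? = walshSum g₀ s ℤ.≟ walshTable-g₀ (toVec s)}
  (Inputs.allTuples-sound 6 walshSum-g₀-fits? fits-ext walshSum-g₀-checked s)
  where
  fits-ext : Ext walshSum-g₀-fits?
  fits-ext eq =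
    cong₂ (λ v w → isYes (v ℤ.≟ w)) (walshSum-cong g₀ eq) (cong walshTable-g₀ (Vec.tabulate-cong eq))

opaque
  unfolding ∑

  g-balanced : ∀ b → fibreSum g (const (+ 1)) b ≡ + 16
  g-balanced false = refl
  g-balanced true  = refl

  g-sensitiveFibres : ∀ j b → fibreSum g (sensitiveAt g j) b ≡ + 6
  g-sensitiveFibres 0F false = refl
  g-sensitiveFibres 0F true  = refl
  g-sensitiveFibres 1F false = refl
  g-sensitiveFibres 1F true  = refl
  g-sensitiveFibres 2F false = refl
  g-sensitiveFibres 2F true  = refl
  g-sensitiveFibres 3F false = refl
  g-sensitiveFibres 3F true  = refl
  g-sensitiveFibres 4F false = refl
  g-sensitiveFibres 4F true  = refl

-- The min-entropy of G₀

profile-complete : ∀ p → p ∈ constant ∷ null ∷ plus ∷ minus ∷ []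
profile-complete constant = here refl
profile-complete null     = there (here refl)
profile-complete plus     = there (there (here refl))
profile-complete minus    = there (there (there (here refl)))

module Profiles = Exhaustive (constant ∷ null ∷ plus ∷ minus ∷ []) profile-complete

profileWalshSum : (Fin 6 → Profile) → ℤ
profileWalshSum t = ∏ (amplitude ∘ t) * walshTable-g₀ (toVec (twisted ∘ t))

profileWalshSum-cong : Ext profileWalshSum
profileWalshSum-cong eq =
  cong₂ _*_ (∏-cong (cong amplitude ∘ eq)) (cong walshTable-g₀ (Vec.tabulate-cong (cong twisted ∘ eq)))

walshSum-G₀ : ∀ α → walshSum G₀ α ≡ profileWalshSum (profile ∘ blocks α)
walshSum-G₀ α = begin
  walshSum G₀ α
    ≡⟨ walshSum-◇-factor g₀ g g₀-ext g-ext α (amplitude ∘ t) (twisted ∘ t) (fibreSum-χ-g ∘ blocks α) ⟩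
  ∏ (amplitude ∘ t) * walshSum g₀ (twisted ∘ t)
    ≡⟨ cong (_*_ (∏ (amplitude ∘ t))) (walshSum-g₀ (twisted ∘ t)) ⟩
  profileWalshSum t ∎
  where
  t : Fin 6 → Profile
  t = profile ∘ blocks α

h₀ : ℚ
h₀ = + 12 / 1

profileBound? : (Fin 6 → Profile) → Bool
profileBound? t = isYes (entropyBound? 30 h₀ (profileWalshSum t))

profileBound-checked : T (Profiles.allTuples 6 profileBound?)
profileBound-checked = _

walshSum-G₀-bound : ∀ α → EntropyBound 30 h₀ (walshSum G₀ α)
walshSum-G₀-bound α = subst (EntropyBound 30 h₀) (sym (walshSum-G₀ α))
  (toWitness {a? = entropyBound? 30 h₀ (profileWalshSum t)}
    (Profiles.allTuples-sound 6 profileBound? profileBound?-ext profileBound-checked t))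
  where
  t : Fin 6 → Profile
  t = profile ∘ blocks α

  profileBound?-ext : Ext profileBound?
  profileBound?-ext = cong (isYes ∘ entropyBound? 30 h₀) ∘ profileWalshSum-cong

α₀ : Input 30
α₀ i = does (i Fin.≟ Fin.# 0) ∨ does (i Fin.≟ Fin.# 5)

opaque
  unfolding ∑

  walshSum-G₀-α₀ : profileWalshSum (profile ∘ blocks α₀) ≡ - (+ 2 ℕ.^ 24)
  walshSum-G₀-α₀ = refl

minEntropy-G₀ : IsMinEntropy G₀ h₀
minEntropy-G₀ = isMinEntropy-byWalshSums G₀ h₀ α₀ (- (+ 2 ℕ.^ 24))
  (trans (walshSum-G₀ α₀) walshSum-G₀-α₀) ((λ ()) , refl) walshSum-G₀-bound

-- The influence of G₀

blockCount : Fin 6 → Fin 6 → ℤ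
blockCount i₀ i = if does (i Fin.≟ i₀) then + 6 else + 16

fibreSum-blockWeight-g : ∀ (i₀ : Fin 6) j₀ i b → fibreSum g (blockWeight g i₀ j₀ i) b ≡ blockCount i₀ i
fibreSum-blockWeight-g i₀ j₀ i b with i Fin.≟ i₀
... | yes _ = g-sensitiveFibres j₀ b
... | no _  = g-balanced b

sensitivity-G₀ : ∀ i₀ j₀ → sensitivity G₀ (combine i₀ j₀) ≡ sensitivity g₀ i₀ * ∏ (blockCount i₀)
sensitivity-G₀ i₀ j₀ = begin
  sensitivity G₀ (combine i₀ j₀)
    ≡⟨ sensitivity-◇ g₀ g g₀-ext g-ext i₀ j₀ ⟩
  ∑ 6 (λ y → sensitiveAt g₀ i₀ y * ∏ (λ i → fibreSum g (blockWeight g i₀ j₀ i) (y i)))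
    ≡⟨ ∑-cong (λ y → cong (_*_ (sensitiveAt g₀ i₀ y)) (∏-cong (λ i → fibreSum-blockWeight-g i₀ j₀ i (y i)))) ⟩
  ∑ 6 (λ y → sensitiveAt g₀ i₀ y * ∏ (blockCount i₀))
    ≡⟨ ∑-distribʳ (∏ (blockCount i₀)) (sensitiveAt g₀ i₀) ⟩
  sensitivity g₀ i₀ * ∏ (blockCount i₀) ∎

sensitivityOfBlock : Fin 30 → ℤ
sensitivityOfBlock t = sensitivity g₀ (quotient 5 t) * ∏ (blockCount (quotient 5 t))

sensitivity-G₀-quotient : ∀ t → sensitivity G₀ t ≡ sensitivityOfBlock t
sensitivity-G₀-quotient t =
  trans (cong (sensitivity G₀) (sym (combine-remQuot {6} 5 t)))
        (sensitivity-G₀ (quotient 5 t) (remainder {6} 5 t))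

opaque
  unfolding ∑

  sensitivityOfBlock-total : sumℤ (map sensitivityOfBlock (allFin 30)) ≡ + (135 ℕ.* 2 ℕ.^ 25)
  sensitivityOfBlock-total = refl

Inf-G₀ : Inf G₀ ≡ + 135 / 32
Inf-G₀ = begin
  Inf G₀
    ≡⟨ Inf-sensitivity G₀ ⟩
  (sumℤ (map (sensitivity G₀) (allFin 30)) / 1) ℚ.* two^ (- (+ 30))
    ≡⟨ cong (λ z → (sumℤ z / 1) ℚ.* two^ (- (+ 30))) (List.map-cong sensitivity-G₀-quotient (allFin 30)) ⟩
  (sumℤ (map sensitivityOfBlock (allFin 30)) / 1) ℚ.* two^ (- (+ 30))
    ≡⟨ cong (λ z → (z / 1) ℚ.* two^ (- (+ 30))) sensitivityOfBlock-total ⟩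
  (+ (135 ℕ.* 2 ℕ.^ 25) / 1) ℚ.* two^ (- (+ 30))
    ≡⟨⟩
  + 135 / 32 ∎

Inf-G₀-nonzero : Inf G₀ ≢ 0ℚ
Inf-G₀-nonzero = subst (_≢ 0ℚ) (sym Inf-G₀) (λ ())

-- Without the explicit x, unification would evaluate Inf G₀.
h₀-ratio : h₀ ≡ (+ 128 / 45) ℚ.* Inf G₀
h₀-ratio = sym (cong (ℚ._*_ (+ 128 / 45)) {x = Inf G₀} Inf-G₀)

mainTheorem6 :
    (Σ ℚ λ h → IsMinEntropy G₀ h × Inf G₀ ≢ 0ℚ × h ≡ ((+ 128) / 45) ℚ.* Inf G₀)
    × (Σ ℕ λ m → Σ (BF m) λ f → Σ ℚ λ h →
         IsMinEntropy f h × Inf f ≢ 0ℚ × h ≡ ((+ 128) / 45) ℚ.* Inf f)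
mainTheorem6 = G₀-ratio , (30 , G₀ , G₀-ratio)
  where
  G₀-ratio : Σ ℚ λ h → IsMinEntropy G₀ h × Inf G₀ ≢ 0ℚ × h ≡ ((+ 128) / 45) ℚ.* Inf G₀
  G₀-ratio = h₀ , minEntropy-G₀ , Inf-G₀-nonzero , h₀-ratio
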